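{- For each of the triplets $(e,e,13)$, $(e,12,e)$, $(e,12,12)$, $(e,12,13)$, $(e,12,23)$, $(e,12,123)$, $(e,12,132)$, $(e,13,13)$, $(e,23,13)$, $(e,123,13)$, $(e,132,13)$, the maximal entry $m_n$ of level $n$ of the associated TRIP-Stern tree satisfies, for all $n\ge 0$, $$m_n=\frac{2^{ -n-1}\left(\left(\sqrt5-3\right)\left(1-\sqrt5\right)^n+\left(3+\sqrt5\right)\left(1+\sqrt5\right)^n\right)}{\sqrt5},$$ and consequently $m_n=m_{n-1}+m_{n-2}$ for $n\ge2$.
   Context: Let $A_0=\begin{pmatrix}0&0&1\\1&0&0\\0&1&1\end{pmatrix}$, $A_1=\begin{pmatrix}1&0&1\\0&1&0\\0&0&1\end{pmatrix}$. Elements of $S_3$ are identified with permutation matrices: $e=I$, $(12)=\begin{pmatrix}0&1&0\\1&0&0\\0&0&1\end{pmatrix}$, $(13)=\begin{pmatrix}0&0&1\\0&1&0\\1&0&0\end{pmatrix}$, $(23)=\begin{pmatrix}1&0&0\\0&0&1\\0&1&0\end{pmatrix}$, $(123)=\begin{pmatrix}0&1&0\\0&0&1\\1&0&0\end{pmatrix}$, $(132)=\begin{pmatrix}0&0&1\\1&0&0\\0&1&0\end{pmatrix}$. For $(\sigma,\tau_0,\tau_1)\in S_3^3$ put $F_0=\sigma A_0\tau_0$, $F_1=\sigma A_1\tau_1$. For $v=(i_1,\dots,i_n)\in\{0,1\}^n$ let $\triangle(v)=(1,1,1)F_{i_1}\cdots F_{i_n}=(b_1(v),b_2(v),b_3(v))$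 (row vector times matrices). The maximal entry of level $n$ is $m_n=\max_{|v|=n}\max_i b_i(v)$, $n\ge0$. -}

module Defs where

open import Data.Nat using (ℕ; zero; suc; _+_; _*_; _⊔_)
open import Data.Integer as ℤ using (ℤ; +_)
open import Data.Fin using (Fin; zero; suc)
open import Data.List using (List; []; _∷_; _++_; concatMap; foldr; map)
open import Data.Product using (_×_; _,_)

Mat : Set
Mat = Fin 3 → Fin 3 → ℕ

Row : Set
Row = Fin 3 → ℕ

i0 i1 i2 : Fin 3
i0 = zero
i1 = suc zero
i2 = suc (suc zero)

mat : ℕ → ℕ → ℕ → ℕ → ℕ → ℕ → ℕ → ℕ → ℕ → Mat
mat a b c d e f g h k zero zero = a
mat a b c d e f g h k zero (suc zero) = b
mat a b c d e f g h k zero (suc (suc zero)) = c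
mat a b c d e f g h k (suc zero) zero = d
mat a b c d e f g h k (suc zero) (suc zero) = e
mat a b c d e f g h k (suc zero) (suc (suc zero)) = f
mat a b c d e f g h k (suc (suc zero)) zero = g
mat a b c d e f g h k (suc (suc zero)) (suc zero) = h
mat a b c d e f g h k (suc (suc zero)) (suc (suc zero)) = k

_⊗_ : Mat → Mat → Mat
(M ⊗ N) i j = M i i0 * N i0 j + M i i1 * N i1 j + M i i2 * N i2 j

_·_ : Row → Mat → Row
(r · M) j = r i0 * M i0 j + r i1 * M i1 j + r i2 * M i2 j

A₀ A₁ : Mat
A₀ = mat 0 0 1
         1 0 0
         0 1 1
A₁ = mat 1 0 1
         0 1 0
         0 0 1

data S3 : Set where
  e p12 p13 p23 p123 p132 : S3

perm : S3 → Mat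
perm e    = mat 1 0 0  0 1 0  0 0 1
perm p12  = mat 0 1 0  1 0 0  0 0 1
perm p13  = mat 0 0 1  0 1 0  1 0 0
perm p23  = mat 1 0 0  0 0 1  0 1 0
perm p123 = mat 0 1 0  0 0 1  1 0 0
perm p132 = mat 0 0 1  1 0 0  0 1 0

Triplet : Set
Triplet = S3 × S3 × S3

F₀ F₁ : Triplet → Mat
F₀ (σ , τ₀ , τ₁) = (perm σ ⊗ A₀) ⊗ perm τ₀
F₁ (σ , τ₀ , τ₁) = (perm σ ⊗ A₁) ⊗ perm τ₁

one3 : Row
one3 _ = 1

-- all triangles △(v) for v ∈ {0,1}ⁿ : (1,1,1) F_{i₁} ⋯ F_{iₙ}
level : Triplet → ℕ → List Row
level t zero    = one3 ∷ []
level t (suc n) = concatMap (λ r → (r · F₀ t) ∷ (r · F₁ t) ∷ []) (level t n)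

maxRow : Row → ℕ
maxRow r = r i0 ⊔ r i1 ⊔ r i2

m : Triplet → ℕ → ℕ
m t n = foldr _⊔_ 0 (map maxRow (level t n))

theTriplets : List Triplet
theTriplets =
    (e , e , p13)
  ∷ (e , p12 , e)
  ∷ (e , p12 , p12)
  ∷ (e , p12 , p13)
  ∷ (e , p12 , p23)
  ∷ (e , p12 , p123)
  ∷ (e , p12 , p132)
  ∷ (e , p13 , p13)
  ∷ (e , p23 , p13)
  ∷ (e , p123 , p13)
  ∷ (e , p132 , p13)
  ∷ []

-- The ring ℤ[√5]: ⟨ a , b ⟩ represents a + b√5 (representation unique since √5 ∉ ℚ)
record ℤ√5 : Set where
  constructor ⟨_,_⟩
  field
    re : ℤ
    im : ℤ

infixl 6 _+√_
infixl 7 _*√_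

_+√_ : ℤ√5 → ℤ√5 → ℤ√5
⟨ a , b ⟩ +√ ⟨ c , d ⟩ = ⟨ a ℤ.+ c , b ℤ.+ d ⟩

_*√_ : ℤ√5 → ℤ√5 → ℤ√5
⟨ a , b ⟩ *√ ⟨ c , d ⟩ = ⟨ a ℤ.* c ℤ.+ + 5 ℤ.* (b ℤ.* d) , a ℤ.* d ℤ.+ b ℤ.* c ⟩

_^√_ : ℤ√5 → ℕ → ℤ√5
x ^√ zero  = ⟨ + 1 , + 0 ⟩
x ^√ suc n = x *√ (x ^√ n)

ι : ℕ → ℤ√5
ι k = ⟨ + k , + 0 ⟩

√5 : ℤ√5
√5 = ⟨ + 0 , + 1 ⟩

-- Multiplying a row (x, y, z) by A₀ or A₁ gives, up to the permutations σ and
-- τ, a row (u, v, w + v) with (u, v, w) a rearrangement of (x, y, z). Hence the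
-- symmetric condition "entries ≤ a, sums of two entries ≤ b, total ≤ b + 1"
-- passes from (a, b) to (b, a + b), and from (1, 1, 1) on it bounds level n by
-- fib (n + 2), for every triplet. Each listed triplet has a branch acting on two
-- fixed positions as (x, z) ↦ (x + z, x); followed from (1, 1, 1) it attains
-- fib (n + 2). Binet's formula is then an identity in ℤ[√5], via
-- (1 + √5)ⁿ = p + q√5 with p + 3q = 2ⁿ fib (n + 2) and p + q = 2ⁿ fib (n + 1).
module Submission where

open import Defs
open import Data.Nat using (ℕ; zero; suc; _+_; _*_; _^_; _≤_; _⊔_; z≤n; s≤s)
open import Data.Nat.Properties
open import Data.Nat.Tactic.RingSolver using (solve-∀)
open import Data.Integer as ℤ using (ℤ; +_; -[1+_])
import Data.Integer.Properties as ℤ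
import Data.Integer.Tactic.RingSolver as ℤ-Solver
open import Data.Fin using (Fin; zero; suc)
open import Data.Product using (_×_; _,_; ∃; proj₁)
open import Data.Sum using (_⊎_; inj₁; inj₂)
open import Data.List using ([]; _∷_; foldr)
open import Data.List.Properties using (foldr-preservesᵇ; foldr-preservesᵒ)
open import Data.List.Relation.Unary.All as All using (All; []; _∷_)
import Data.List.Relation.Unary.All.Properties as All
import Data.List.Relation.Unary.Any as Any
open import Data.List.Relation.Unary.Any using (here; there)
open import Data.List.Membership.Propositional using (_∈_)
open import Data.List.Membership.Propositional.Properties using (∈-map⁺; ∈-concatMap⁺)
open import Function using (_∘_)
open import Relation.Binary.PropositionalEquality
  using (_≡_; _≗_; refl; sym; trans; cong; cong₂; module ≡-Reasoning)

fib : ℕ → ℕ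
fib zero          = 0
fib (suc zero)    = 1
fib (suc (suc n)) = fib (suc n) + fib n

1≤fib-suc : ∀ n → 1 ≤ fib (suc n)
1≤fib-suc zero    = s≤s z≤n
1≤fib-suc (suc n) = ≤-trans (1≤fib-suc n) (m≤m+n (fib (suc n)) (fib n))

-- Rows times matrices

·-congˡ : ∀ {r s} → r ≗ s → ∀ M → r · M ≗ s · M
·-congˡ r≗s M j rewrite r≗s i0 | r≗s i1 | r≗s i2 = refl

·-⊗-assoc : ∀ r M N → r · (M ⊗ N) ≗ (r · M) · N
·-⊗-assoc r M N j =
  expand (r i0) (r i1) (r i2) (M i0 i0) (M i0 i1) (M i0 i2) (M i1 i0) (M i1 i1) (M i1 i2)
         (M i2 i0) (M i2 i1) (M i2 i2) (N i0 j) (N i1 j) (N i2 j)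
  where
  expand : ∀ r₀ r₁ r₂ m₀₀ m₀₁ m₀₂ m₁₀ m₁₁ m₁₂ m₂₀ m₂₁ m₂₂ n₀ n₁ n₂ →
    r₀ * (m₀₀ * n₀ + m₀₁ * n₁ + m₀₂ * n₂) + r₁ * (m₁₀ * n₀ + m₁₁ * n₁ + m₁₂ * n₂)
      + r₂ * (m₂₀ * n₀ + m₂₁ * n₁ + m₂₂ * n₂)
    ≡ (r₀ * m₀₀ + r₁ * m₁₀ + r₂ * m₂₀) * n₀ + (r₀ * m₀₁ + r₁ * m₁₁ + r₂ * m₂₁) * n₁
      + (r₀ * m₀₂ + r₁ * m₁₂ + r₂ * m₂₂) * n₂
  expand = solve-∀

pick₀ : ∀ (r : Row) → r i0 * 1 + r i1 * 0 + r i2 * 0 ≡ r i0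
pick₀ r = lemma (r i0) (r i1) (r i2)
  where
  lemma : ∀ x y z → x * 1 + y * 0 + z * 0 ≡ x
  lemma = solve-∀

pick₁ : ∀ (r : Row) → r i0 * 0 + r i1 * 1 + r i2 * 0 ≡ r i1
pick₁ r = lemma (r i0) (r i1) (r i2)
  where
  lemma : ∀ x y z → x * 0 + y * 1 + z * 0 ≡ y
  lemma = solve-∀

pick₂ : ∀ (r : Row) → r i0 * 0 + r i1 * 0 + r i2 * 1 ≡ r i2
pick₂ r = lemma (r i0) (r i1) (r i2)
  where
  lemma : ∀ x y z → x * 0 + y * 0 + z * 1 ≡ z
  lemma = solve-∀

pick₀₂ : ∀ (r : Row) → r i0 * 1 + r i1 * 0 + r i2 * 1 ≡ r i0 + r i2
pick₀₂ r = lemma (r i0) (r i1) (r i2)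
  where
  lemma : ∀ x y z → x * 1 + y * 0 + z * 1 ≡ x + z
  lemma = solve-∀

⟦_⟧ : S3 → Fin 3 → Fin 3
⟦ e    ⟧ j                = j
⟦ p12  ⟧ zero             = i1
⟦ p12  ⟧ (suc zero)       = i0
⟦ p12  ⟧ (suc (suc zero)) = i2
⟦ p13  ⟧ zero             = i2
⟦ p13  ⟧ (suc zero)       = i1
⟦ p13  ⟧ (suc (suc zero)) = i0
⟦ p23  ⟧ zero             = i0
⟦ p23  ⟧ (suc zero)       = i2
⟦ p23  ⟧ (suc (suc zero)) = i1
⟦ p123 ⟧ zero             = i2
⟦ p123 ⟧ (suc zero)       = i0
⟦ p123 ⟧ (suc (suc zero)) = i1
⟦ p132 ⟧ zero             = i1
⟦ p132 ⟧ (suc zero)       = i2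
⟦ p132 ⟧ (suc (suc zero)) = i0

·-perm : ∀ r τ → r · perm τ ≗ r ∘ ⟦ τ ⟧
·-perm r e    zero             = pick₀ r
·-perm r e    (suc zero)       = pick₁ r
·-perm r e    (suc (suc zero)) = pick₂ r
·-perm r p12  zero             = pick₁ r
·-perm r p12  (suc zero)       = pick₀ r
·-perm r p12  (suc (suc zero)) = pick₂ r
·-perm r p13  zero             = pick₂ r
·-perm r p13  (suc zero)       = pick₁ r
·-perm r p13  (suc (suc zero)) = pick₀ r
·-perm r p23  zero             = pick₀ r
·-perm r p23  (suc zero)       = pick₂ r
·-perm r p23  (suc (suc zero)) = pick₁ r
·-perm r p123 zero             = pick₂ r
·-perm r p123 (suc zero)       = pick₀ r
·-perm r p123 (suc (suc zero)) = pick₁ r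
·-perm r p132 zero             = pick₁ r
·-perm r p132 (suc zero)       = pick₂ r
·-perm r p132 (suc (suc zero)) = pick₀ r

·-σAτ : ∀ r σ A τ → r · ((perm σ ⊗ A) ⊗ perm τ) ≗ ((r ∘ ⟦ σ ⟧) · A) ∘ ⟦ τ ⟧
·-σAτ r σ A τ j = begin
  (r · ((perm σ ⊗ A) ⊗ perm τ)) j   ≡⟨ ·-⊗-assoc r (perm σ ⊗ A) (perm τ) j ⟩
  ((r · (perm σ ⊗ A)) · perm τ) j   ≡⟨ ·-perm (r · (perm σ ⊗ A)) τ j ⟩
  (r · (perm σ ⊗ A)) (⟦ τ ⟧ j)      ≡⟨ ·-⊗-assoc r (perm σ) A (⟦ τ ⟧ j) ⟩
  ((r · perm σ) · A) (⟦ τ ⟧ j)      ≡⟨ ·-congˡ (·-perm r σ) A (⟦ τ ⟧ j) ⟩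
  ((r ∘ ⟦ σ ⟧) · A) (⟦ τ ⟧ j)       ∎
  where open ≡-Reasoning

-- The level invariant

record Bounded (a b x y z : ℕ) : Set where
  constructor bounded
  field
    x≤a : x ≤ a
    y≤a : y ≤ a
    z≤a : z ≤ a
    x+y≤b : x + y ≤ b
    x+z≤b : x + z ≤ b
    y+z≤b : y + z ≤ b
    x+y+z≤1+b : x + y + z ≤ suc b

Bounded-cong : ∀ {a b x y z x′ y′ z′} → x ≡ x′ → y ≡ y′ → z ≡ z′ →
               Bounded a b x y z → Bounded a b x′ y′ z′
Bounded-cong refl refl refl bd = bd

swap₁₂ : ∀ {a b x y z} → Bounded a b x y z → Bounded a b y x z
swap₁₂ {b = b} {x} {y} {z} (bounded x≤a y≤a z≤a x+y≤b x+z≤b y+z≤b x+y+z≤1+b) =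
  bounded y≤a x≤a z≤a (≤-trans (≤-reflexive (+-comm y x)) x+y≤b) y+z≤b x+z≤b
          (≤-trans (≤-reflexive (cong (_+ z) (+-comm y x))) x+y+z≤1+b)

swap₂₃ : ∀ {a b x y z} → Bounded a b x y z → Bounded a b x z y
swap₂₃ {b = b} {x} {y} {z} (bounded x≤a y≤a z≤a x+y≤b x+z≤b y+z≤b x+y+z≤1+b) =
  bounded x≤a z≤a y≤a x+z≤b x+y≤b (≤-trans (≤-reflexive (+-comm z y)) y+z≤b)
          (≤-trans (≤-reflexive (rearrange x y z)) x+y+z≤1+b)
  where
  rearrange : ∀ x y z → x + z + y ≡ x + y + z
  rearrange = solve-∀

grow : ∀ {a b u v w} → 1 ≤ a → Bounded a b u v w → Bounded b (b + a) u v (w + v)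
grow {a} {b} {u} {v} {w} 1≤a (bounded u≤a v≤a w≤a u+v≤b u+w≤b v+w≤b u+v+w≤1+b) =
  bounded (≤-trans (m≤m+n u v) u+v≤b) (≤-trans (m≤n+m v u) u+v≤b)
          (≤-trans (≤-reflexive (+-comm w v)) v+w≤b)
          (≤-trans u+v≤b (m≤m+n b a))
          (begin u + (w + v)  ≡⟨ rearrange₁ u v w ⟩
                 u + v + w    ≤⟨ u+v+w≤1+b ⟩
                 suc b        ≡⟨ +-comm 1 b ⟩
                 b + 1        ≤⟨ +-monoʳ-≤ b 1≤a ⟩
                 b + a        ∎)
          (begin v + (w + v)  ≡⟨ rearrange₂ v w ⟩
                 v + w + v    ≤⟨ +-mono-≤ v+w≤b v≤a ⟩
                 b + a        ∎)
          (begin u + v + (w + v)  ≡⟨ rearrange₃ u v w ⟩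
                 u + v + w + v    ≤⟨ +-mono-≤ u+v+w≤1+b v≤a ⟩
                 suc (b + a)      ∎)
  where
  open ≤-Reasoning
  rearrange₁ : ∀ u v w → u + (w + v) ≡ u + v + w
  rearrange₁ = solve-∀
  rearrange₂ : ∀ v w → v + (w + v) ≡ v + w + v
  rearrange₂ = solve-∀
  rearrange₃ : ∀ u v w → u + v + (w + v) ≡ u + v + w + v
  rearrange₃ = solve-∀

record BoundedRow (a b : ℕ) (r : Row) : Set where
  constructor boundedRow
  field entries : Bounded a b (r i0) (r i1) (r i2)

BoundedRow-cong : ∀ {a b r s} → r ≗ s → BoundedRow a b r → BoundedRow a b s
BoundedRow-cong r≗s (boundedRow bd) = boundedRow (Bounded-cong (r≗s i0) (r≗s i1) (r≗s i2) bd)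

BoundedRow-perm : ∀ {a b r} τ → BoundedRow a b r → BoundedRow a b (r ∘ ⟦ τ ⟧)
BoundedRow-perm e    (boundedRow bd) = boundedRow bd
BoundedRow-perm p12  (boundedRow bd) = boundedRow (swap₁₂ bd)
BoundedRow-perm p13  (boundedRow bd) = boundedRow (swap₁₂ (swap₂₃ (swap₁₂ bd)))
BoundedRow-perm p23  (boundedRow bd) = boundedRow (swap₂₃ bd)
BoundedRow-perm p123 (boundedRow bd) = boundedRow (swap₁₂ (swap₂₃ bd))
BoundedRow-perm p132 (boundedRow bd) = boundedRow (swap₂₃ (swap₁₂ bd))

BoundedRow-·A₀ : ∀ {a b r} → 1 ≤ a → BoundedRow a b r → BoundedRow b (b + a) (r · A₀)
BoundedRow-·A₀ {r = r} 1≤a bd =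
  let boundedRow bd′ = BoundedRow-perm p132 bd
  in boundedRow (Bounded-cong (sym (pick₁ r)) (sym (pick₂ r)) (sym (pick₀₂ r)) (grow 1≤a bd′))

BoundedRow-·A₁ : ∀ {a b r} → 1 ≤ a → BoundedRow a b r → BoundedRow b (b + a) (r · A₁)
BoundedRow-·A₁ {r = r} 1≤a bd =
  let boundedRow bd′ = BoundedRow-perm p12 bd
  in boundedRow (Bounded-cong (sym (pick₀ r)) (sym (pick₁ r))
                              (sym (trans (pick₀₂ r) (+-comm (r i0) (r i2))))
                              (swap₁₂ (grow 1≤a bd′)))

BoundedRow-·σAτ : ∀ {a b r} σ A τ →
  (∀ {s} → BoundedRow a b s → BoundedRow b (b + a) (s · A)) →
  BoundedRow a b r → BoundedRow b (b + a) (r · ((perm σ ⊗ A) ⊗ perm τ))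
BoundedRow-·σAτ {r = r} σ A τ A-grows bd =
  BoundedRow-cong (sym ∘ ·-σAτ r σ A τ) (BoundedRow-perm τ (A-grows (BoundedRow-perm σ bd)))

level-bounded : ∀ t n → All (BoundedRow (fib (2 + n)) (fib (3 + n))) (level t n)
level-bounded t zero =
  boundedRow (bounded ≤-refl ≤-refl ≤-refl ≤-refl ≤-refl ≤-refl ≤-refl) ∷ []
level-bounded t@(σ , τ₀ , τ₁) (suc n) =
  All.concat⁺ (All.map⁺ (All.map children (level-bounded t n)))
  where
  1≤a : 1 ≤ fib (2 + n)
  1≤a = 1≤fib-suc (suc n)
  children : ∀ {r} → BoundedRow (fib (2 + n)) (fib (3 + n)) r →
             All (BoundedRow (fib (3 + n)) (fib (4 + n))) (r · F₀ t ∷ r · F₁ t ∷ [])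
  children bd = BoundedRow-·σAτ σ A₀ τ₀ (BoundedRow-·A₀ 1≤a) bd
              ∷ BoundedRow-·σAτ σ A₁ τ₁ (BoundedRow-·A₁ 1≤a) bd ∷ []

entry≤maxRow : ∀ r i → r i ≤ maxRow r
entry≤maxRow r zero             = ≤-trans (m≤m⊔n (r i0) (r i1)) (m≤m⊔n _ (r i2))
entry≤maxRow r (suc zero)       = ≤-trans (m≤n⊔m (r i0) (r i1)) (m≤m⊔n _ (r i2))
entry≤maxRow r (suc (suc zero)) = m≤n⊔m (r i0 ⊔ r i1) (r i2)

maxRow≤ : ∀ {a b r} → BoundedRow a b r → maxRow r ≤ a
maxRow≤ (boundedRow (bounded x≤a y≤a z≤a _ _ _ _)) = ⊔-lub (⊔-lub x≤a y≤a) z≤a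

m≤fib : ∀ t n → m t n ≤ fib (2 + n)
m≤fib t n =
  foldr-preservesᵇ {P = _≤ fib (2 + n)} ⊔-lub z≤n (All.map⁺ (All.map maxRow≤ (level-bounded t n)))

∈⇒≤foldr-⊔ : ∀ {x xs} → x ∈ xs → x ≤ foldr _⊔_ 0 xs
∈⇒≤foldr-⊔ {x} {xs} x∈xs =
  foldr-preservesᵒ preserves 0 xs (inj₂ (Any.map (λ { refl → ≤-refl }) x∈xs))
  where
  preserves : ∀ y z → x ≤ y ⊎ x ≤ z → x ≤ y ⊔ z
  preserves y z (inj₁ x≤y) = ≤-trans x≤y (m≤m⊔n y z)
  preserves y z (inj₂ x≤z) = ≤-trans x≤z (m≤n⊔m y z)

maxRow≤m : ∀ {t n r} → r ∈ level t n → maxRow r ≤ m t n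
maxRow≤m r∈ = ∈⇒≤foldr-⊔ (∈-map⁺ maxRow r∈)

·F₀∈level : ∀ t n {r} → r ∈ level t n → r · F₀ t ∈ level t (suc n)
·F₀∈level t n r∈ = ∈-concatMap⁺ _ (Any.map (λ { refl → here refl }) r∈)

·F₁∈level : ∀ t n {r} → r ∈ level t n → r · F₁ t ∈ level t (suc n)
·F₁∈level t n r∈ = ∈-concatMap⁺ _ (Any.map (λ { refl → there (here refl) }) r∈)

record FibonacciBranch (t : Triplet) : Set where
  field
    M : Mat
    M-child : ∀ {n r} → r ∈ level t n → r · M ∈ level t (suc n)
    i j : Fin 3
    M-adds : ∀ r → (r · M) i ≡ r i + r j
    M-shifts : ∀ r → (r · M) j ≡ r i

  fibonacci-row : ∀ n → ∃ λ r → r ∈ level t n × r i ≡ fib (2 + n) × r j ≡ fib (1 + n)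
  fibonacci-row zero = one3 , here refl , refl , refl
  fibonacci-row (suc n) with fibonacci-row n
  ... | r , r∈ , ri , rj =
    r · M , M-child {n} r∈ , trans (M-adds r) (cong₂ _+_ ri rj) , trans (M-shifts r) ri

  fib≤m : ∀ n → fib (2 + n) ≤ m t n
  fib≤m n =
    let r , r∈ , ri , _ = fibonacci-row n
    in ≤-trans (≤-reflexive (sym ri)) (≤-trans (entry≤maxRow r i) (maxRow≤m {t} {n} r∈))

m≡fib : ∀ {t} → FibonacciBranch t → ∀ n → m t n ≡ fib (2 + n)
m≡fib {t} branch n = ≤-antisym (m≤fib t n) (FibonacciBranch.fib≤m branch n)

F₁-fibonacciBranch : ∀ τ₀ → FibonacciBranch (e , τ₀ , p13)
F₁-fibonacciBranch τ₀ = record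
  { M = F₁ (e , τ₀ , p13) ; M-child = λ {n} → ·F₁∈level (e , τ₀ , p13) n ; i = i0 ; j = i2
  ; M-adds = pick₀₂ ; M-shifts = pick₀ }

F₀-fibonacciBranch : ∀ τ₁ → FibonacciBranch (e , p12 , τ₁)
F₀-fibonacciBranch τ₁ = record
  { M = F₀ (e , p12 , τ₁) ; M-child = λ {n} → ·F₀∈level (e , p12 , τ₁) n ; i = i2 ; j = i0
  ; M-adds = λ r → trans (pick₀₂ r) (+-comm (r i0) (r i2)) ; M-shifts = pick₂ }

theTriplets-fibonacciBranch : All FibonacciBranch theTriplets
theTriplets-fibonacciBranch =
    F₁-fibonacciBranch e
  ∷ F₀-fibonacciBranch e
  ∷ F₀-fibonacciBranch p12
  ∷ F₀-fibonacciBranch p13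
  ∷ F₀-fibonacciBranch p23
  ∷ F₀-fibonacciBranch p123
  ∷ F₀-fibonacciBranch p132
  ∷ F₁-fibonacciBranch p13
  ∷ F₁-fibonacciBranch p23
  ∷ F₁-fibonacciBranch p123
  ∷ F₁-fibonacciBranch p132
  ∷ []

-- Binet's formula in ℤ[√5]

open ℤ√5 using (re; im)

α β : ℤ√5
α = ⟨ + 1 , + 1 ⟩
β = ⟨ + 1 , -[1+ 0 ] ⟩

conj : ℤ√5 → ℤ√5
conj ⟨ a , b ⟩ = ⟨ a , ℤ.- b ⟩

β*conj≡conj[α*] : ∀ x → β *√ conj x ≡ conj (α *√ x)
β*conj≡conj[α*] ⟨ a , b ⟩ = cong₂ ⟨_,_⟩ (re-eq a b) (im-eq a b)
  where
  re-eq : ∀ a b → + 1 ℤ.* a ℤ.+ + 5 ℤ.* (-[1+ 0 ] ℤ.* ℤ.- b)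
                  ≡ + 1 ℤ.* a ℤ.+ + 5 ℤ.* (+ 1 ℤ.* b)
  re-eq = ℤ-Solver.solve-∀
  im-eq : ∀ a b → + 1 ℤ.* ℤ.- b ℤ.+ -[1+ 0 ] ℤ.* a ≡ ℤ.- (+ 1 ℤ.* b ℤ.+ + 1 ℤ.* a)
  im-eq = ℤ-Solver.solve-∀

β^≡conj[α^] : ∀ n → β ^√ n ≡ conj (α ^√ n)
β^≡conj[α^] zero    = refl
β^≡conj[α^] (suc n) = trans (cong (β *√_) (β^≡conj[α^] n)) (β*conj≡conj[α*] (α ^√ n))

α^-fib : ∀ n → re (α ^√ n) ℤ.+ + 3 ℤ.* im (α ^√ n) ≡ + (2 ^ n) ℤ.* + fib (2 + n)
             × re (α ^√ n) ℤ.+ im (α ^√ n) ≡ + (2 ^ n) ℤ.* + fib (1 + n)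
α^-fib zero    = refl , refl
α^-fib (suc n) =
  let p+3q≡kF , p+q≡kG = α^-fib n in
  (begin
    re (α *√ x) ℤ.+ + 3 ℤ.* im (α *√ x)       ≡⟨ split₁ p q ⟩
    + 2 ℤ.* (p ℤ.+ + 3 ℤ.* q) ℤ.+ + 2 ℤ.* (p ℤ.+ q)
      ≡⟨ cong₂ (λ u v → + 2 ℤ.* u ℤ.+ + 2 ℤ.* v) p+3q≡kF p+q≡kG ⟩
    + 2 ℤ.* (K ℤ.* F) ℤ.+ + 2 ℤ.* (K ℤ.* G)   ≡⟨ merge K F G ⟩
    (+ 2 ℤ.* K) ℤ.* (F ℤ.+ G)
      ≡⟨ sym (cong₂ ℤ._*_ (ℤ.pos-* 2 (2 ^ n)) (ℤ.pos-+ (fib (2 + n)) (fib (1 + n)))) ⟩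
    + (2 ^ suc n) ℤ.* + fib (3 + n)           ∎)
  , (begin
    re (α *√ x) ℤ.+ im (α *√ x)   ≡⟨ split₂ p q ⟩
    + 2 ℤ.* (p ℤ.+ + 3 ℤ.* q)     ≡⟨ cong (+ 2 ℤ.*_) p+3q≡kF ⟩
    + 2 ℤ.* (K ℤ.* F)             ≡⟨ sym (ℤ.*-assoc (+ 2) K F) ⟩
    (+ 2 ℤ.* K) ℤ.* F             ≡⟨ cong (ℤ._* F) (sym (ℤ.pos-* 2 (2 ^ n))) ⟩
    + (2 ^ suc n) ℤ.* F           ∎)
  where
  open ≡-Reasoning
  x : ℤ√5
  x = α ^√ n
  p q K F G : ℤ
  p = re x
  q = im x
  K = + (2 ^ n)
  F = + fib (2 + n)
  G = + fib (1 + n)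
  split₁ : ∀ p q → (+ 1 ℤ.* p ℤ.+ + 5 ℤ.* (+ 1 ℤ.* q)) ℤ.+ + 3 ℤ.* (+ 1 ℤ.* q ℤ.+ + 1 ℤ.* p)
                   ≡ + 2 ℤ.* (p ℤ.+ + 3 ℤ.* q) ℤ.+ + 2 ℤ.* (p ℤ.+ q)
  split₁ = ℤ-Solver.solve-∀
  split₂ : ∀ p q → (+ 1 ℤ.* p ℤ.+ + 5 ℤ.* (+ 1 ℤ.* q)) ℤ.+ (+ 1 ℤ.* q ℤ.+ + 1 ℤ.* p)
                   ≡ + 2 ℤ.* (p ℤ.+ + 3 ℤ.* q)
  split₂ = ℤ-Solver.solve-∀
  merge : ∀ K F G → + 2 ℤ.* (K ℤ.* F) ℤ.+ + 2 ℤ.* (K ℤ.* G) ≡ (+ 2 ℤ.* K) ℤ.* (F ℤ.+ G)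
  merge = ℤ-Solver.solve-∀

ι*√5*ι : ∀ k l → ι k *√ √5 *√ ι l ≡ ⟨ + 0 , + k ℤ.* + l ⟩
ι*√5*ι k l = cong₂ ⟨_,_⟩ (re-eq (+ k) (+ l)) (im-eq (+ k) (+ l))
  where
  re-eq : ∀ K L → (K ℤ.* + 0 ℤ.+ + 5 ℤ.* (+ 0 ℤ.* + 1)) ℤ.* L
                  ℤ.+ + 5 ℤ.* ((K ℤ.* + 1 ℤ.+ + 0 ℤ.* + 0) ℤ.* + 0)
                  ≡ + 0
  re-eq = ℤ-Solver.solve-∀
  im-eq : ∀ K L → (K ℤ.* + 0 ℤ.+ + 5 ℤ.* (+ 0 ℤ.* + 1)) ℤ.* + 0
                  ℤ.+ (K ℤ.* + 1 ℤ.+ + 0 ℤ.* + 0) ℤ.* L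
                  ≡ K ℤ.* L
  im-eq = ℤ-Solver.solve-∀

binet-combination : ∀ x → ⟨ -[1+ 2 ] , + 1 ⟩ *√ conj x +√ ⟨ + 3 , + 1 ⟩ *√ x
                          ≡ ⟨ + 0 , + 2 ℤ.* (re x ℤ.+ + 3 ℤ.* im x) ⟩
binet-combination ⟨ a , b ⟩ = cong₂ ⟨_,_⟩ (re-eq a b) (im-eq a b)
  where
  re-eq : ∀ a b → (-[1+ 2 ] ℤ.* a ℤ.+ + 5 ℤ.* (+ 1 ℤ.* ℤ.- b)) ℤ.+ (+ 3 ℤ.* a ℤ.+ + 5 ℤ.* (+ 1 ℤ.* b))
                  ≡ + 0
  re-eq = ℤ-Solver.solve-∀
  im-eq : ∀ a b → (-[1+ 2 ] ℤ.* ℤ.- b ℤ.+ + 1 ℤ.* a) ℤ.+ (+ 3 ℤ.* b ℤ.+ + 1 ℤ.* a)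
                  ≡ + 2 ℤ.* (a ℤ.+ + 3 ℤ.* b)
  im-eq = ℤ-Solver.solve-∀

binet : ∀ n → ι (2 ^ suc n) *√ √5 *√ ι (fib (2 + n))
              ≡ ⟨ -[1+ 2 ] , + 1 ⟩ *√ (β ^√ n) +√ ⟨ + 3 , + 1 ⟩ *√ (α ^√ n)
binet n = begin
  ι (2 ^ suc n) *√ √5 *√ ι (fib (2 + n))
    ≡⟨ ι*√5*ι (2 ^ suc n) (fib (2 + n)) ⟩
  ⟨ + 0 , + (2 ^ suc n) ℤ.* + fib (2 + n) ⟩
    ≡⟨ cong ⟨ + 0 ,_⟩ scaled ⟩
  ⟨ + 0 , + 2 ℤ.* (re x ℤ.+ + 3 ℤ.* im x) ⟩
    ≡⟨ sym (binet-combination x) ⟩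
  ⟨ -[1+ 2 ] , + 1 ⟩ *√ conj x +√ ⟨ + 3 , + 1 ⟩ *√ x
    ≡⟨ cong (λ y → ⟨ -[1+ 2 ] , + 1 ⟩ *√ y +√ ⟨ + 3 , + 1 ⟩ *√ x) (sym (β^≡conj[α^] n)) ⟩
  ⟨ -[1+ 2 ] , + 1 ⟩ *√ (β ^√ n) +√ ⟨ + 3 , + 1 ⟩ *√ (α ^√ n)
    ∎
  where
  open ≡-Reasoning
  x : ℤ√5
  x = α ^√ n
  scaled : + (2 ^ suc n) ℤ.* + fib (2 + n) ≡ + 2 ℤ.* (re x ℤ.+ + 3 ℤ.* im x)
  scaled = begin
    + (2 ^ suc n) ℤ.* + fib (2 + n)       ≡⟨ cong (ℤ._* + fib (2 + n)) (ℤ.pos-* 2 (2 ^ n)) ⟩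
    (+ 2 ℤ.* + (2 ^ n)) ℤ.* + fib (2 + n) ≡⟨ ℤ.*-assoc (+ 2) (+ (2 ^ n)) (+ fib (2 + n)) ⟩
    + 2 ℤ.* (+ (2 ^ n) ℤ.* + fib (2 + n)) ≡⟨ cong (+ 2 ℤ.*_) (sym (proj₁ (α^-fib n))) ⟩
    + 2 ℤ.* (re x ℤ.+ + 3 ℤ.* im x)       ∎

theorem12 : (t : Triplet) → t ∈ theTriplets →
    ((n : ℕ) → ι (2 ^ suc n) *√ √5 *√ ι (m t n)
                 ≡ ⟨ -[1+ 2 ] , + 1 ⟩ *√ (⟨ + 1 , -[1+ 0 ] ⟩ ^√ n)
                   +√ ⟨ + 3 , + 1 ⟩ *√ (⟨ + 1 , + 1 ⟩ ^√ n))
    × ((n : ℕ) → m t (suc (suc n)) ≡ m t (suc n) + m t n)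
theorem12 t t∈ =
    (λ n → trans (cong (λ k → ι (2 ^ suc n) *√ √5 *√ ι k) (m≡fib[2+n] n)) (binet n))
  , (λ n → trans (m≡fib[2+n] (2 + n)) (sym (cong₂ _+_ (m≡fib[2+n] (1 + n)) (m≡fib[2+n] n))))
  where
  m≡fib[2+n] : ∀ n → m t n ≡ fib (2 + n)
  m≡fib[2+n] = m≡fib (All.lookup theTriplets-fibonacciBranch t∈)
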